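{- Let $\Gamma=(V,E)$ be a finite simple connected graph with diameter $D=D(\Gamma)$ satisfying $$d_\Gamma(x,y)\le 2+d_\Gamma(z_1,z_2)\quad\text{for all } x,y,z_1,z_2\in V \text{ with } d_\Gamma(x,z_1)=d_\Gamma(y,z_2)=D.$$ Then $d_{\Box\Gamma}(x^+,y^-)=D+1-d_\Gamma(x,y)$ for all $x,y\in V$ if and only if every geodesic (shortest path) in $\Gamma$ is contained in a geodesic of $\Gamma$ of length $D$.
   Context: $d_\Gamma$ is the shortest-path distance and $D(\Gamma)$ the maximum of $d_\Gamma$ over all pairs of vertices. The diametral doubling $\Box\Gamma$ has vertex set $V^+\cup V^-$, where $V^+=\{x^+:x\in V\}$ and $V^-=\{x^-:x\in V\}$ are two disjoint copies of $V$; $x^\mu$ is adjacent to $y^\epsilon$ if either $\mu=\epsilon$ and $\{x,y\}\in E$, or $\mu\ne\epsilon$ and $d_\Gamma(x,y)=D(\Gamma)$. -}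

module Defs where

open import Data.Nat using (ℕ; zero; suc; _+_; _⊔_; _≡ᵇ_)
open import Data.Bool using (Bool; true; false; _∧_; if_then_else_; T)
open import Data.Fin using (Fin; _↑ˡ_; _↑ʳ_; splitAt)
open import Data.Fin.Properties using (_≟_)
open import Data.List using (List; []; _∷_; length; _++_; foldr; map; allFin)
open import Data.Bool.ListAction using (any)
open import Data.Sum using (inj₁; inj₂)
open import Data.Product using (_×_; Σ; ∃; ∃-syntax)
open import Data.Unit using (⊤)
open import Relation.Nullary.Decidable using (⌊_⌋)
open import Relation.Binary.PropositionalEquality using (_≡_)

record SimpleGraph (n : ℕ) : Set where
  field
    adj     : Fin n → Fin n → Bool
    symm    : ∀ x y → adj x y ≡ adj y x
    irrefl  : ∀ x → adj x x ≡ false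
open SimpleGraph public

module _ {m : ℕ} (A : Fin m → Fin m → Bool) where

  walkOf : ℕ → Fin m → Fin m → Bool
  walkOf zero    x y = ⌊ x ≟ y ⌋
  walkOf (suc k) x y = any (λ z → A x z ∧ walkOf k z y) (allFin m)

  private
    search : ℕ → ℕ → Fin m → Fin m → ℕ
    search zero       k x y = k
    search (suc fuel) k x y = if walkOf k x y then k else search fuel (suc k) x y

  -- shortest-path distance: least k with a walk of length k from x to y
  -- (any shortest walk has length < m; if y is unreachable the value is m,
  --  which never occurs in a connected graph)
  distOf : Fin m → Fin m → ℕ
  distOf x y = search m 0 x y

  ConnectedOf : Set
  ConnectedOf = ∀ x y → ∃[ k ] T (walkOf k x y)

module _ {n : ℕ} (Γ : SimpleGraph n) where

  d : Fin n → Fin n → ℕ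
  d = distOf (adj Γ)

  Connected : Set
  Connected = ConnectedOf (adj Γ)

  diam : ℕ
  diam = foldr _⊔_ 0 (map (λ x → foldr _⊔_ 0 (map (λ y → d x y) (allFin n))) (allFin n))

  boxAdj : Fin (n + n) → Fin (n + n) → Bool
  boxAdj i j with splitAt n i | splitAt n j
  ... | inj₁ x | inj₁ y = adj Γ x y
  ... | inj₂ x | inj₂ y = adj Γ x y
  ... | inj₁ x | inj₂ y = d x y ≡ᵇ diam
  ... | inj₂ x | inj₁ y = d x y ≡ᵇ diam

  _⁺ : Fin n → Fin (n + n)
  x ⁺ = x ↑ˡ n

  _⁻ : Fin n → Fin (n + n)
  x ⁻ = n ↑ʳ x

  dBox : Fin (n + n) → Fin (n + n) → ℕ
  dBox = distOf boxAdj

  -- a path given by its start vertex and the list of subsequent vertices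
  IsWalkFrom : Fin n → List (Fin n) → Set
  IsWalkFrom x []       = ⊤
  IsWalkFrom x (y ∷ ys) = T (adj Γ x y) × IsWalkFrom y ys

  lastFrom : Fin n → List (Fin n) → Fin n
  lastFrom x []       = x
  lastFrom x (y ∷ ys) = lastFrom y ys

  IsGeodesic : Fin n → List (Fin n) → Set
  IsGeodesic x xs = IsWalkFrom x xs × length xs ≡ d x (lastFrom x xs)

  InDiametralGeodesic : Fin n → List (Fin n) → Set
  InDiametralGeodesic x xs =
    Σ (Fin n) λ y → Σ (List (Fin n)) λ ys → Σ (List (Fin n)) λ pre → Σ (List (Fin n)) λ post →
      IsGeodesic y ys × length ys ≡ diam × (y ∷ ys) ≡ pre ++ (x ∷ xs) ++ post

{-# OPTIONS --safe #-}
module Submission where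

-- A walk in □Γ from x⁺ to y⁻ crosses between the two copies an odd number of times.  By the
-- hypothesis, crossing twice is never shorter than staying on one side, so a walk of length k
-- yields a diametral pair u, v with d(x,u) + 1 + d(v,y) ≤ k; since D = d(u,v) ≤ d(u,x) + d(x,y)
-- + d(y,v), this gives d□(x⁺,y⁻) ≥ D + 1 − d(x,y).  Equality for x, y means that the shortest
-- such detour is tight, i.e. geodesics u → x, x → y, y → v concatenate to a geodesic of length D,
-- and any geodesic from x to y may be put in the middle.  Conversely a diametral geodesic through
-- a geodesic from x to y gives the walk x⁺ ⋯ u⁺ v⁻ ⋯ y⁻ of length D + 1 − d(x,y).
-- The distance of Defs is a bounded search; it is correct because a shortest walk never repeats
-- a vertex, hence has fewer than n edges.

open import Defs
open import Data.Nat using (ℕ; zero; suc; _+_; _∸_; _≤_; _<_; _⊔_; z≤n; s≤s; >-nonZero⁻¹)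
open import Data.Nat.Properties
  using (_≟_; ≤-trans; ≤-antisym; ≤-reflexive; <⇒≤; <⇒≱; ≤-<-trans; ≤∧≢⇒<; ≤-pred; 1+n≰n; n≤0⇒n≡0;
         m<m+n; m≤m+n; m≤n+m; m∸n≤m; m≤n+o⇒m∸n≤o; m≤o∸n⇒m+n≤o; m+n∸m≡n; +-identityʳ; +-suc; +-comm;
         +-monoˡ-≤; +-monoʳ-≤; ⊔-lub; m≤m⊔n; m≤n⇒m≤o⊔n; <⇒≤pred; suc-pred; ≡ᵇ⇒≡; ≡⇒≡ᵇ;
         module ≤-Reasoning)
open import Data.Nat.Tactic.RingSolver using (solve-∀)
open import Data.Fin using (Fin; zero; suc; splitAt; _↑ˡ_; _↑ʳ_)
open import Data.Fin.Properties using (splitAt-↑ˡ; splitAt-↑ʳ; injective⇒≤; nonZeroIndex)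
open import Data.Bool using (Bool; true; false; T; if_then_else_)
open import Data.Bool.Properties using (T-∧)
open import Data.List using (List; []; _∷_; [_]; _++_; length; lookup; foldr; map; allFin)
open import Data.List.Properties using (length-++; ++-assoc)
open import Data.List.Relation.Unary.All as All using ([]; _∷_)
open import Data.List.Relation.Unary.All.Properties using (¬Any⇒All¬)
open import Data.List.Relation.Unary.AllPairs using ([]; _∷_)
open import Data.List.Relation.Unary.Any using (here; there; satisfied)
open import Data.List.Relation.Unary.Any.Properties using (any⁺; any⁻)
open import Data.List.Relation.Unary.Unique.Propositional using (Unique)
open import Data.List.Membership.Propositional using (_∈_; _∉_; lose)
open import Data.List.Membership.Propositional.Properties using (∈-allFin; ∈-lookup; ∈-∃++)
open import Data.Product as Product using (∃; ∃₂; _×_; _,_; proj₁; proj₂)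
open import Data.Sum as Sum using (_⊎_; inj₁; inj₂)
open import Data.Empty using (⊥-elim)
open import Data.Unit using (tt)
open import Function.Bundles using (_⇔_; mk⇔; Equivalence)
open import Function.Definitions using (Injective)
open import Relation.Nullary.Decidable using (yes; no; toWitness; fromWitness)
open import Relation.Binary.PropositionalEquality
  using (_≡_; refl; sym; trans; cong; cong₂; subst; subst₂)

record Walk {m : ℕ} (A : Fin m → Fin m → Bool) (k : ℕ) (x y : Fin m) : Set where
  constructor walk
  field holds : T (walkOf A k x y)

module _ {m : ℕ} {A : Fin m → Fin m → Bool} where

  walk-[] : ∀ {x} → Walk A 0 x x
  walk-[] = walk (fromWitness refl)

  walk-[]⁻ : ∀ {x y} → Walk A 0 x y → x ≡ y
  walk-[]⁻ (walk w) = toWitness w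

  walk-∷ : ∀ {k x z y} → T (A x z) → Walk A k z y → Walk A (suc k) x y
  walk-∷ {z = z} e (walk w) = walk (any⁺ _ (lose (∈-allFin z) (Equivalence.from T-∧ (e , w))))

  walk-∷⁻ : ∀ {k x y} → Walk A (suc k) x y → ∃ λ z → T (A x z) × Walk A k z y
  walk-∷⁻ (walk w) with satisfied (any⁻ _ (allFin m) w)
  ... | z , e∧w with Equivalence.to T-∧ e∧w
  ...   | e , w′ = z , e , walk w′

  walk-++ : ∀ {j k x y z} → Walk A j x y → Walk A k y z → Walk A (j + k) x z
  walk-++ {zero} w v with walk-[]⁻ w
  ... | refl = v
  walk-++ {suc j} w v with walk-∷⁻ w
  ... | _ , e , w′ = walk-∷ e (walk-++ w′ v)

walk-map : ∀ {m m′} {A : Fin m → Fin m → Bool} {B : Fin m′ → Fin m′ → Bool} (f : Fin m → Fin m′) →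
           (∀ {x y} → T (A x y) → T (B (f x) (f y))) →
           ∀ {k x y} → Walk A k x y → Walk B k (f x) (f y)
walk-map f f-edge {zero} w with walk-[]⁻ w
... | refl = walk-[]
walk-map f f-edge {suc k} w with walk-∷⁻ w
... | _ , e , w′ = walk-∷ (f-edge e) (walk-map f f-edge w′)

-- Defs computes distOf by this search but keeps it private.
search : ∀ {m} (A : Fin m → Fin m → Bool) (fuel k : ℕ) (x y : Fin m) → ℕ
search A zero       k x y = k
search A (suc fuel) k x y = if walkOf A k x y then k else search A fuel (suc k) x y

module _ {m : ℕ} {A : Fin m → Fin m → Bool} {x y : Fin m} where

  search-minimal : ∀ fuel {k r} → k ≤ r → Walk A r x y → search A fuel k x y ≤ r
  search-minimal zero       k≤r w = k≤r
  search-minimal (suc fuel) {k} {r} k≤r w with walkOf A k x y in eq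
  ... | true  = k≤r
  ... | false with k ≟ r
  ...   | yes refl = ⊥-elim (subst T eq (Walk.holds w))
  ...   | no k≢r   = search-minimal fuel (≤∧≢⇒< k≤r k≢r) w

  search-sound : ∀ fuel k → search A fuel k x y ≡ k + fuel ⊎ Walk A (search A fuel k x y) x y
  search-sound zero       k = inj₁ (sym (+-identityʳ k))
  search-sound (suc fuel) k with walkOf A k x y in eq
  ... | true  = inj₂ (walk (subst T (sym eq) tt))
  ... | false = Sum.map₁ (λ e → trans e (sym (+-suc k fuel))) (search-sound fuel (suc k))

  least-walk : ∀ {k} → Walk A k x y → ∃ λ r → Walk A r x y × (∀ {j} → Walk A j x y → r ≤ j)
  least-walk {k} w with search-sound (suc k) 0
  ... | inj₁ r≡1+k = ⊥-elim (1+n≰n (subst (_≤ k) r≡1+k (search-minimal (suc k) z≤n w)))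
  ... | inj₂ w′    = _ , w′ , search-minimal (suc k) z≤n

-- The left-hand side of search-private≡search is a metavariable; the call in distOf≡search,
-- once `with` has generalised all its arguments to variables, solves it as the private search.
mutual
  private
    search-private≡search : ∀ {m} (A : Fin m → Fin m → Bool) x y fuel k → _ ≡ search A fuel k x y
    search-private≡search A x y zero       k = refl
    search-private≡search A x y (suc fuel) k =
      cong (if walkOf A k x y then k else_) (search-private≡search A x y fuel (suc k))

  distOf≡search : ∀ {m} (A : Fin m → Fin m → Bool) x y → distOf A x y ≡ search A m 0 x y
  distOf≡search {suc m} A x y with suc m | 1
  ... | _ | k = cong (if walkOf A 0 x y then 0 else_) (search-private≡search A x y m k)

module _ {m : ℕ} {A : Fin m → Fin m → Bool} {x y : Fin m} where

  distOf-minimal : ∀ {k} → Walk A k x y → distOf A x y ≤ k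
  distOf-minimal w rewrite distOf≡search A x y = search-minimal m z≤n w

  distOf-sound : distOf A x y ≡ m ⊎ Walk A (distOf A x y) x y
  distOf-sound rewrite distOf≡search A x y = search-sound m 0

unique⇒lookup-injective : ∀ {a} {X : Set a} {xs : List X} → Unique xs → Injective _≡_ _≡_ (lookup xs)
unique⇒lookup-injective (_ ∷ _)   {zero}  {zero}  _  = refl
unique⇒lookup-injective (x∉ ∷ _)  {zero}  {suc j} eq = ⊥-elim (All.lookup x∉ (∈-lookup j) eq)
unique⇒lookup-injective (x∉ ∷ _)  {suc i} {zero}  eq = ⊥-elim (All.lookup x∉ (∈-lookup i) (sym eq))
unique⇒lookup-injective (_ ∷ uxs) {suc i} {suc j} eq = cong suc (unique⇒lookup-injective uxs eq)

unique⇒length≤ : ∀ {n} {xs : List (Fin n)} → Unique xs → length xs ≤ n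
unique⇒length≤ uxs = injective⇒≤ (unique⇒lookup-injective uxs)

foldr-⊔-upper : ∀ {a} {X : Set a} (f : X → ℕ) {x xs} → x ∈ xs → f x ≤ foldr _⊔_ 0 (map f xs)
foldr-⊔-upper f (here refl) = m≤m⊔n _ _
foldr-⊔-upper f (there x∈xs) = m≤n⇒m≤o⊔n _ (foldr-⊔-upper f x∈xs)

foldr-⊔-least : ∀ {a} {X : Set a} (f : X → ℕ) xs {b} → (∀ x → f x ≤ b) → foldr _⊔_ 0 (map f xs) ≤ b
foldr-⊔-least f []       f≤b = z≤n
foldr-⊔-least f (x ∷ xs) f≤b = ⊔-lub (f≤b x) (foldr-⊔-least f xs f≤b)

a+[1+c]≤n+1∸b⇒a+[b+c]≤n : ∀ {a b c n} → b ≤ n → a + suc c ≤ n + 1 ∸ b → a + (b + c) ≤ n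
a+[1+c]≤n+1∸b⇒a+[b+c]≤n {a} {b} {c} {n} b≤n le = ≤-pred (begin
  suc (a + (b + c))  ≡⟨ +-rearrange a b c ⟩
  a + suc c + b      ≤⟨ m≤o∸n⇒m+n≤o _ (≤-trans b≤n (m≤m+n n 1)) le ⟩
  n + 1              ≡⟨ +-comm n 1 ⟩
  suc n              ∎)
  where
    open ≤-Reasoning
    +-rearrange : ∀ a b c → suc (a + (b + c)) ≡ a + suc c + b
    +-rearrange = solve-∀

module Paths {n : ℕ} (Γ : SimpleGraph n) where

  lastFrom-++ : ∀ x xs ys → lastFrom Γ x (xs ++ ys) ≡ lastFrom Γ (lastFrom Γ x xs) ys
  lastFrom-++ x []       ys = refl
  lastFrom-++ x (z ∷ xs) ys = lastFrom-++ z xs ys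

  IsWalkFrom-++ : ∀ {x} xs {ys} → IsWalkFrom Γ x xs → IsWalkFrom Γ (lastFrom Γ x xs) ys →
                  IsWalkFrom Γ x (xs ++ ys)
  IsWalkFrom-++ []       _       q = q
  IsWalkFrom-++ (z ∷ xs) (e , p) q = e , IsWalkFrom-++ xs p q

  IsWalkFrom-++⁻ : ∀ {x} xs {ys} → IsWalkFrom Γ x (xs ++ ys) →
                   IsWalkFrom Γ x xs × IsWalkFrom Γ (lastFrom Γ x xs) ys
  IsWalkFrom-++⁻ []       p       = tt , p
  IsWalkFrom-++⁻ (z ∷ xs) (e , p) = Product.map₁ (e ,_) (IsWalkFrom-++⁻ xs p)

  path⇒walk : ∀ {x} xs → IsWalkFrom Γ x xs → Walk (adj Γ) (length xs) x (lastFrom Γ x xs)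
  path⇒walk []       _       = walk-[]
  path⇒walk (z ∷ xs) (e , p) = walk-∷ e (path⇒walk xs p)

  walk⇒path : ∀ {k x y} → Walk (adj Γ) k x y →
              ∃ λ xs → IsWalkFrom Γ x xs × length xs ≡ k × lastFrom Γ x xs ≡ y
  walk⇒path {zero} w = [] , tt , refl , walk-[]⁻ w
  walk⇒path {suc k} w with walk-∷⁻ w
  ... | z , e , w′ with walk⇒path w′
  ...   | xs , p , refl , last≡y = z ∷ xs , (e , p) , refl , last≡y

  walk-reverse : ∀ {k x y} → Walk (adj Γ) k x y → Walk (adj Γ) k y x
  walk-reverse {zero} w with walk-[]⁻ w
  ... | refl = walk-[]
  walk-reverse {suc k} {x} {y} w with walk-∷⁻ w
  ... | z , e , w′ = subst (λ j → Walk (adj Γ) j y x) (+-comm k 1)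
                       (walk-++ (walk-reverse w′) (walk-∷ (subst T (symm Γ x z) e) walk-[]))

  split-last : ∀ x xs → ∃ λ pre → x ∷ xs ≡ pre ++ [ lastFrom Γ x xs ]
  split-last x []       = [] , refl
  split-last x (z ∷ xs) = Product.map (x ∷_) (cong (x ∷_)) (split-last z xs)

  prefix-walk : ∀ pre {u ys x zs} → IsWalkFrom Γ u ys → u ∷ ys ≡ pre ++ x ∷ zs →
                Walk (adj Γ) (length pre) u x × IsWalkFrom Γ x zs × lastFrom Γ x zs ≡ lastFrom Γ u ys
  prefix-walk []              p       refl = walk-[] , p , refl
  prefix-walk (_ ∷ [])        (e , p) refl = walk-∷ e walk-[] , p , refl
  prefix-walk (_ ∷ z ∷ pre)   (e , p) refl with prefix-walk (z ∷ pre) p refl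
  ... | w , q , last≡ = walk-∷ e w , q , last≡

  Shortest : Fin n → List (Fin n) → Set
  Shortest x xs = ∀ {ys} → IsWalkFrom Γ x ys → lastFrom Γ x ys ≡ lastFrom Γ x xs → length xs ≤ length ys

  shortest⇒∉ : ∀ {x} xs → IsWalkFrom Γ x xs → Shortest x xs → x ∉ xs
  shortest⇒∉ {x} xs p shortest x∈xs with ∈-∃++ x∈xs
  ... | pre , post , refl = 1+n≰n (begin
    suc (length post)               ≤⟨ m≤n+m _ (length pre) ⟩
    length pre + suc (length post)  ≡⟨ length-++ pre ⟨
    length (pre ++ x ∷ post)        ≤⟨ shortest post-walk (sym (lastFrom-++ x pre (x ∷ post))) ⟩
    length post                     ∎)
    where
      open ≤-Reasoning
      post-walk : IsWalkFrom Γ x post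
      post-walk = proj₂ (proj₂ (IsWalkFrom-++⁻ pre p))

  shortest⇒unique : ∀ {x} xs → IsWalkFrom Γ x xs → Shortest x xs → Unique (x ∷ xs)
  shortest⇒unique []       _       _        = [] ∷ []
  shortest⇒unique (z ∷ xs) (e , p) shortest =
    ¬Any⇒All¬ _ (shortest⇒∉ (z ∷ xs) (e , p) shortest)
    ∷ shortest⇒unique xs p (λ q last≡ → ≤-pred (shortest (e , q) last≡))

  extend-segment : ∀ {u x} ps xs qs → IsWalkFrom Γ u ps → lastFrom Γ u ps ≡ x → IsWalkFrom Γ x xs →
                   IsWalkFrom Γ (lastFrom Γ x xs) qs →
                   IsWalkFrom Γ u (ps ++ xs ++ qs)
                   × lastFrom Γ u (ps ++ xs ++ qs) ≡ lastFrom Γ (lastFrom Γ x xs) qs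
                   × ∃ λ pre → u ∷ ps ++ xs ++ qs ≡ pre ++ (x ∷ xs) ++ qs
  extend-segment {u} ps xs qs p refl q r with split-last u ps
  ... | pre , u∷ps≡ =
      IsWalkFrom-++ ps p (IsWalkFrom-++ xs q r)
    , trans (lastFrom-++ u ps (xs ++ qs)) (lastFrom-++ _ xs qs)
    , pre , trans (cong (_++ xs ++ qs) u∷ps≡) (++-assoc pre _ (xs ++ qs))

  walk⇒short-walk : ∀ {k x y} → Walk (adj Γ) k x y → ∃ λ r → r < n × Walk (adj Γ) r x y
  walk⇒short-walk w with least-walk w
  ... | _ , w′ , least with walk⇒path w′
  ...   | xs , p , refl , refl = length xs , unique⇒length≤ (shortest⇒unique xs p shortest) , w′
    where
      shortest : Shortest _ xs
      shortest {ys} q last≡ = least (subst (Walk (adj Γ) (length ys) _) last≡ (path⇒walk ys q))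

  walk⇒d<n : ∀ {k x y} → Walk (adj Γ) k x y → d Γ x y < n
  walk⇒d<n w with walk⇒short-walk w
  ... | _ , r<n , w′ = ≤-<-trans (distOf-minimal w′) r<n

  walk⇒d-walk : ∀ {k x y} → Walk (adj Γ) k x y → Walk (adj Γ) (d Γ x y) x y
  walk⇒d-walk w with distOf-sound {A = adj Γ}
  ... | inj₁ d≡n = ⊥-elim (1+n≰n (subst (_< n) d≡n (walk⇒d<n w)))
  ... | inj₂ w′  = w′

module Metric {n : ℕ} (Γ : SimpleGraph n) (connected : Connected Γ) where
  open Paths Γ public

  some-walk : ∀ x y → Walk (adj Γ) (proj₁ (connected x y)) x y
  some-walk x y = walk (proj₂ (connected x y))

  d-walk : ∀ x y → Walk (adj Γ) (d Γ x y) x y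
  d-walk x y = walk⇒d-walk (some-walk x y)

  d<n : ∀ x y → d Γ x y < n
  d<n x y = walk⇒d<n (some-walk x y)

  d-refl : ∀ x → d Γ x x ≡ 0
  d-refl x = n≤0⇒n≡0 (distOf-minimal {A = adj Γ} walk-[])

  d-sym : ∀ x y → d Γ x y ≡ d Γ y x
  d-sym x y = ≤-antisym (distOf-minimal (walk-reverse (d-walk y x)))
                        (distOf-minimal (walk-reverse (d-walk x y)))

  d-edge : ∀ {x y} z → T (adj Γ x y) → d Γ x z ≤ suc (d Γ y z)
  d-edge z e = distOf-minimal (walk-∷ e (d-walk _ z))

  d-tri : ∀ x y z → d Γ x z ≤ d Γ x y + d Γ y z
  d-tri x y z = distOf-minimal (walk-++ (d-walk x y) (d-walk y z))

  d≤detour : ∀ u x y v → d Γ u v ≤ d Γ x u + (d Γ x y + d Γ v y)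
  d≤detour u x y v = distOf-minimal
    (walk-++ (walk-reverse (d-walk x u)) (walk-++ (d-walk x y) (walk-reverse (d-walk v y))))

  d≤diam : ∀ x y → d Γ x y ≤ diam Γ
  d≤diam x y = ≤-trans (foldr-⊔-upper (d Γ x) (∈-allFin y))
                       (foldr-⊔-upper (λ x → foldr _⊔_ 0 (map (d Γ x) (allFin n))) (∈-allFin x))

  diam+1≤n : Fin n → diam Γ + 1 ≤ n
  diam+1≤n x₀ = subst₂ _≤_ (+-comm 1 (diam Γ)) (suc-pred n {{nonZeroIndex x₀}})
    (s≤s (foldr-⊔-least _ (allFin n) λ x → foldr-⊔-least _ (allFin n) λ y → <⇒≤pred (d<n x y)))

module Doubling {n : ℕ} (Γ : SimpleGraph n) (connected : Connected Γ)
  (H : ∀ x y z₁ z₂ → d Γ x z₁ ≡ diam Γ → d Γ y z₂ ≡ diam Γ → d Γ x y ≤ 2 + d Γ z₁ z₂) where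
  open Metric Γ connected

  edge⁺ : ∀ {x y} → T (adj Γ x y) → T (boxAdj Γ (x ↑ˡ n) (y ↑ˡ n))
  edge⁺ {x} {y} e rewrite splitAt-↑ˡ n x n | splitAt-↑ˡ n y n = e

  edge⁻ : ∀ {x y} → T (adj Γ x y) → T (boxAdj Γ (n ↑ʳ x) (n ↑ʳ y))
  edge⁻ {x} {y} e rewrite splitAt-↑ʳ n n x | splitAt-↑ʳ n n y = e

  edge⁺⁻ : ∀ {x y} → d Γ x y ≡ diam Γ → T (boxAdj Γ (x ↑ˡ n) (n ↑ʳ y))
  edge⁺⁻ {x} {y} xy rewrite splitAt-↑ˡ n x n | splitAt-↑ʳ n n y = ≡⇒≡ᵇ _ _ xy

  DiametralDetour : Fin n → Fin n → ℕ → Set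
  DiametralDetour a b k = ∃₂ λ u v → d Γ u v ≡ diam Γ × d Γ a u + suc (d Γ v b) ≤ k

  -- What a walk of length k in □Γ between copies of a and b guarantees (inj₁ = +, inj₂ = −).
  SideBound : Fin n ⊎ Fin n → Fin n ⊎ Fin n → ℕ → Set
  SideBound (inj₁ a) (inj₁ b) k = d Γ a b ≤ k
  SideBound (inj₂ a) (inj₂ b) k = d Γ a b ≤ k
  SideBound (inj₁ a) (inj₂ b) k = DiametralDetour a b k
  SideBound (inj₂ a) (inj₁ b) k = DiametralDetour a b k

  sideBound-refl : ∀ s → SideBound s s 0
  sideBound-refl (inj₁ a) = ≤-reflexive (d-refl a)
  sideBound-refl (inj₂ a) = ≤-reflexive (d-refl a)

  d-step : ∀ {a c b k} → T (adj Γ a c) → d Γ c b ≤ k → d Γ a b ≤ suc k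
  d-step e cb≤k = ≤-trans (d-edge _ e) (s≤s cb≤k)

  detour-step : ∀ {a c b k} → T (adj Γ a c) → DiametralDetour c b k → DiametralDetour a b (suc k)
  detour-step e (u , v , uv , le) = u , v , uv , ≤-trans (+-monoˡ-≤ _ (d-edge u e)) (s≤s le)

  detour-start : ∀ {a c b k} → d Γ a c ≡ diam Γ → d Γ c b ≤ k → DiametralDetour a b (suc k)
  detour-start {a} {c} {b} {k} ac cb≤k =
    a , c , ac , subst (λ t → t + suc (d Γ c b) ≤ suc k) (sym (d-refl a)) (s≤s cb≤k)

  -- Two crossings plus the part from c to u are no shorter than a path from a to v: this is H.
  detour-close : ∀ {a c b k} → d Γ a c ≡ diam Γ → DiametralDetour c b k → d Γ a b ≤ suc k
  detour-close {a} {c} {b} {k} ac (u , v , uv , le) = begin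
    d Γ a b                        ≤⟨ d-tri a v b ⟩
    d Γ a v + d Γ v b              ≤⟨ +-monoˡ-≤ _ (H a v c u ac (trans (d-sym v u) uv)) ⟩
    suc (suc (d Γ c u)) + d Γ v b  ≡⟨ cong suc (sym (+-suc (d Γ c u) (d Γ v b))) ⟩
    suc (d Γ c u + suc (d Γ v b))  ≤⟨ s≤s le ⟩
    suc k                          ∎
    where open ≤-Reasoning

  sideBound-step : ∀ i z j {k} → T (boxAdj Γ i z) → SideBound (splitAt n z) (splitAt n j) k →
                   SideBound (splitAt n i) (splitAt n j) (suc k)
  sideBound-step i z j e with splitAt n i | splitAt n z | splitAt n j
  ... | inj₁ _ | inj₁ _ | inj₁ _ = d-step e
  ... | inj₁ _ | inj₁ _ | inj₂ _ = detour-step e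
  ... | inj₁ _ | inj₂ _ | inj₁ _ = detour-close (≡ᵇ⇒≡ _ _ e)
  ... | inj₁ _ | inj₂ _ | inj₂ _ = detour-start (≡ᵇ⇒≡ _ _ e)
  ... | inj₂ _ | inj₂ _ | inj₂ _ = d-step e
  ... | inj₂ _ | inj₂ _ | inj₁ _ = detour-step e
  ... | inj₂ _ | inj₁ _ | inj₂ _ = detour-close (≡ᵇ⇒≡ _ _ e)
  ... | inj₂ _ | inj₁ _ | inj₁ _ = detour-start (≡ᵇ⇒≡ _ _ e)

  box-walk⇒sideBound : ∀ {k i j} → Walk (boxAdj Γ) k i j → SideBound (splitAt n i) (splitAt n j) k
  box-walk⇒sideBound {zero} {i} w with walk-[]⁻ w
  ... | refl = sideBound-refl (splitAt n i)
  box-walk⇒sideBound {suc k} {i} {j} w with walk-∷⁻ w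
  ... | z , e , w′ = sideBound-step i z j e (box-walk⇒sideBound w′)

  box-walk⇒detour : ∀ {k x y} → Walk (boxAdj Γ) k (x ↑ˡ n) (n ↑ʳ y) → DiametralDetour x y k
  box-walk⇒detour {k} {x} {y} w =
    subst₂ (λ s t → SideBound s t k) (splitAt-↑ˡ n x n) (splitAt-↑ʳ n n y) (box-walk⇒sideBound w)

  dBox⇒detour : ∀ x y → dBox Γ (x ↑ˡ n) (n ↑ʳ y) ≡ n + n ⊎ DiametralDetour x y (dBox Γ (x ↑ˡ n) (n ↑ʳ y))
  dBox⇒detour x y = Sum.map₂ box-walk⇒detour (distOf-sound {A = boxAdj Γ})

  beyond-diameter : ∀ {x y} L → dBox Γ (x ↑ˡ n) (n ↑ʳ y) ≡ n + n →
                    diam Γ + 1 ∸ L < dBox Γ (x ↑ˡ n) (n ↑ʳ y)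
  beyond-diameter {x} {y} L far = begin-strict
    diam Γ + 1 ∸ L             ≤⟨ m∸n≤m _ L ⟩
    diam Γ + 1                 ≤⟨ diam+1≤n x ⟩
    n                          <⟨ m<m+n n (>-nonZero⁻¹ n {{nonZeroIndex x}}) ⟩
    n + n                      ≡⟨ sym far ⟩
    dBox Γ (x ↑ˡ n) (n ↑ʳ y)   ∎
    where open ≤-Reasoning

  dBox≤⇒detour : ∀ {x y} L → dBox Γ (x ↑ˡ n) (n ↑ʳ y) ≤ diam Γ + 1 ∸ L →
                 DiametralDetour x y (dBox Γ (x ↑ˡ n) (n ↑ʳ y))
  dBox≤⇒detour {x} {y} L near with dBox⇒detour x y
  ... | inj₁ far    = ⊥-elim (<⇒≱ (beyond-diameter L far) near)
  ... | inj₂ detour = detour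

  detour⇒bound : ∀ {x y k} → DiametralDetour x y k → diam Γ + 1 ≤ d Γ x y + k
  detour⇒bound {x} {y} {k} (u , v , uv , le) = begin
    diam Γ + 1                           ≡⟨ cong (_+ 1) (sym uv) ⟩
    d Γ u v + 1                          ≤⟨ +-monoˡ-≤ 1 (d≤detour u x y v) ⟩
    d Γ x u + (d Γ x y + d Γ v y) + 1    ≡⟨ +-rearrange (d Γ x u) (d Γ x y) (d Γ v y) ⟩
    d Γ x y + (d Γ x u + suc (d Γ v y))  ≤⟨ +-monoʳ-≤ (d Γ x y) le ⟩
    d Γ x y + k                          ∎
    where
      open ≤-Reasoning
      +-rearrange : ∀ a b c → a + (b + c) + 1 ≡ b + (a + suc c)
      +-rearrange = solve-∀

  dBox-lower : ∀ x y → diam Γ + 1 ∸ d Γ x y ≤ dBox Γ (x ↑ˡ n) (n ↑ʳ y)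
  dBox-lower x y with dBox⇒detour x y
  ... | inj₁ far    = <⇒≤ (beyond-diameter (d Γ x y) far)
  ... | inj₂ detour = m≤n+o⇒m∸n≤o _ _ (detour⇒bound detour)

  InDiametralGeodesic⇒dBox≤ : ∀ {x} xs → IsWalkFrom Γ x xs → InDiametralGeodesic Γ x xs →
                              dBox Γ (x ↑ˡ n) (n ↑ʳ lastFrom Γ x xs) ≤ diam Γ + 1 ∸ length xs
  InDiametralGeodesic⇒dBox≤ {x} xs p (u , ys , pre , post , (ys-walk , ys-length) , ys≡D , u∷ys≡)
    with prefix-walk pre ys-walk u∷ys≡
  ... | ux , xs++post-walk , last≡ = begin
    dBox Γ (x ↑ˡ n) (n ↑ʳ y)                                 ≤⟨ distOf-minimal box-walk ⟩
    length pre + suc (length post)                           ≡⟨ m+n∸m≡n (length xs) _ ⟨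
    length xs + (length pre + suc (length post)) ∸ length xs ≡⟨ cong (_∸ length xs) D+1≡ ⟨
    diam Γ + 1 ∸ length xs                                   ∎
    where
      open ≤-Reasoning
      y : Fin n
      y = lastFrom Γ x xs
      yv : Walk (adj Γ) (length post) y (lastFrom Γ u ys)
      yv = subst (Walk (adj Γ) _ y) (trans (sym (lastFrom-++ x xs post)) last≡)
                 (path⇒walk post (proj₂ (IsWalkFrom-++⁻ xs xs++post-walk)))
      box-walk : Walk (boxAdj Γ) (length pre + suc (length post)) (x ↑ˡ n) (n ↑ʳ y)
      box-walk = walk-++ (walk-map (_↑ˡ n) edge⁺ (walk-reverse ux))
                         (walk-∷ (edge⁺⁻ (trans (sym ys-length) ys≡D))
                                 (walk-map (n ↑ʳ_) edge⁻ (walk-reverse yv)))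
      +-rearrange : ∀ a b c → a + suc (b + c) ≡ b + (a + suc c)
      +-rearrange = solve-∀
      D+1≡ : diam Γ + 1 ≡ length xs + (length pre + suc (length post))
      D+1≡ = begin-equality
        diam Γ + 1                                   ≡⟨ trans (cong (_+ 1) (sym ys≡D)) (+-comm _ 1) ⟩
        length (u ∷ ys)                              ≡⟨ cong length u∷ys≡ ⟩
        length (pre ++ x ∷ xs ++ post)               ≡⟨ length-++ pre ⟩
        length pre + suc (length (xs ++ post))       ≡⟨ cong (λ l → length pre + suc l) (length-++ xs) ⟩
        length pre + suc (length xs + length post)   ≡⟨ +-rearrange (length pre) (length xs) _ ⟩
        length xs + (length pre + suc (length post)) ∎

  detour⇒InDiametralGeodesic : ∀ {x k} xs → IsGeodesic Γ x xs → DiametralDetour x (lastFrom Γ x xs) k →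
                               k ≤ diam Γ + 1 ∸ d Γ x (lastFrom Γ x xs) → InDiametralGeodesic Γ x xs
  detour⇒InDiametralGeodesic {x} {k} xs (p , xs-length) (u , v , uv , le) k≤
    with walk⇒path (walk-reverse (d-walk x u)) | walk⇒path (walk-reverse (d-walk v (lastFrom Γ x xs)))
  ... | ps , ps-walk , ps-length , ps-last | qs , qs-walk , qs-length , refl
    with extend-segment ps xs qs ps-walk ps-last p qs-walk
  ... | zs-walk , zs-last , pre , u∷zs≡ =
    u , zs , pre , qs , (zs-walk , trans zs≡D (trans (sym uv) (cong (d Γ u) (sym zs-last))))
      , zs≡D , u∷zs≡
    where
      y : Fin n
      y = lastFrom Γ x xs
      zs : List (Fin n)
      zs = ps ++ xs ++ qs
      zs-length : length zs ≡ d Γ x u + (length xs + d Γ v y)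
      zs-length = trans (length-++ ps)
                        (cong₂ _+_ ps-length (trans (length-++ xs) (cong (length xs +_) qs-length)))
      zs≤D : length zs ≤ diam Γ
      zs≤D = subst (_≤ diam Γ) (sym zs-length)
        (a+[1+c]≤n+1∸b⇒a+[b+c]≤n (subst (_≤ diam Γ) (sym xs-length) (d≤diam x y))
                                 (≤-trans le (subst (λ l → k ≤ diam Γ + 1 ∸ l) (sym xs-length) k≤)))
      D≤zs : diam Γ ≤ length zs
      D≤zs = subst (_≤ length zs) uv
        (distOf-minimal (subst (Walk (adj Γ) _ u) zs-last (path⇒walk zs zs-walk)))
      zs≡D : length zs ≡ diam Γ
      zs≡D = ≤-antisym zs≤D D≤zs

  geodesics-extend : (∀ x y → dBox Γ (x ↑ˡ n) (n ↑ʳ y) ≡ diam Γ + 1 ∸ d Γ x y) →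
                     ∀ x xs → IsGeodesic Γ x xs → InDiametralGeodesic Γ x xs
  geodesics-extend formula x xs geodesic =
    detour⇒InDiametralGeodesic xs geodesic (dBox≤⇒detour (d Γ x (lastFrom Γ x xs)) tight) tight
    where
      tight : dBox Γ (x ↑ˡ n) (n ↑ʳ lastFrom Γ x xs) ≤ diam Γ + 1 ∸ d Γ x (lastFrom Γ x xs)
      tight = ≤-reflexive (formula x (lastFrom Γ x xs))

  dBox-formula : (∀ x xs → IsGeodesic Γ x xs → InDiametralGeodesic Γ x xs) →
                 ∀ x y → dBox Γ (x ↑ˡ n) (n ↑ʳ y) ≡ diam Γ + 1 ∸ d Γ x y
  dBox-formula extend x y with walk⇒path (d-walk x y)
  ... | xs , p , xs-length , refl =
    ≤-antisym (subst (λ L → dBox Γ (x ↑ˡ n) (n ↑ʳ y) ≤ diam Γ + 1 ∸ L) xs-length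
                     (InDiametralGeodesic⇒dBox≤ xs p (extend x xs (p , xs-length))))
              (dBox-lower x y)

lemma8 : (n : ℕ) (Γ : SimpleGraph n) → Connected Γ →
    (∀ x y z₁ z₂ → d Γ x z₁ ≡ diam Γ → d Γ y z₂ ≡ diam Γ → d Γ x y ≤ 2 + d Γ z₁ z₂) →
    ((∀ x y → dBox Γ (_⁺ Γ x) (_⁻ Γ y) ≡ diam Γ + 1 ∸ d Γ x y)
      ⇔ (∀ x (xs : List (Fin n)) → IsGeodesic Γ x xs → InDiametralGeodesic Γ x xs))
lemma8 n Γ connected H = mk⇔ geodesics-extend dBox-formula
  where open Doubling Γ connected H
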